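{- Let $G$ be a finite group of order at least $3$, let $\Gamma_G$ be its power graph and let $M_G$ be the set of maximal involutions of $G$. Then $$\mathrm{rc}(\Gamma_G)=\begin{cases}3, & \text{if } 1\le |M_G|\le 2,\\ |M_G|, & \text{if } |M_G|\ge 3.\end{cases}$$
   Context: For a finite group $G$ with identity $e$, the power graph $\Gamma_G$ is the undirected graph with vertex set $G$ in which two distinct elements are adjacent if one is a power of the other. An involution is an element of order $2$. An involution $x$ is maximal if the only cyclic subgroup of $G$ containing $x$ is $\langle x\rangle$; $M_G$ denotes the set of maximal involutions of $G$. For a connected graph $\Gamma$, an edge coloring $\zeta:E(\Gamma)\to\{1,\dots,k\}$ (adjacent edges may receive the same color) is a rainbow $k$-coloring if every pair of vertices is joined by a path whose edges have pairwise distinct colors; the rainbow connection number $\mathrm{rc}(\Gamma)$ is the minimum $k$ for which a rainbow $k$-coloring exists. -}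

module Defs where

open import Data.Nat using (ℕ; zero; suc; _<_)
open import Data.Fin using (Fin)
open import Data.Product using (Σ; ∃; _×_; _,_)
open import Data.Sum using (_⊎_)
open import Data.List using (List; []; _∷_)
open import Data.List.Relation.Unary.Unique.Propositional using (Unique)
open import Relation.Binary.PropositionalEquality using (_≡_; _≢_)
open import Relation.Nullary using (¬_)
open import Function.Definitions using (Injective)
open import Algebra.Core using (Op₂)

HasSize : {n : ℕ} → (Fin n → Set) → ℕ → Set
HasSize {n} P m =
  Σ (Fin m → Fin n) λ f →
    Injective _≡_ _≡_ f × (∀ x → (P x → ∃ λ i → f i ≡ x) × (∀ i → P (f i)))

module PowerGraph {n : ℕ} (_∙_ : Op₂ (Fin n)) (ε : Fin n) where

  pow : Fin n → ℕ → Fin n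
  pow y zero    = ε
  pow y (suc k) = y ∙ pow y k

  -- x is a power of y  (i.e. x ∈ ⟨y⟩; in a finite group ℕ-powers suffice)
  IsPowerOf : Fin n → Fin n → Set
  IsPowerOf x y = ∃ λ k → x ≡ pow y k

  Adj : Fin n → Fin n → Set
  Adj x y = x ≢ y × (IsPowerOf x y ⊎ IsPowerOf y x)

  IsInvolution : Fin n → Set
  IsInvolution x = x ≢ ε × (x ∙ x ≡ ε)

  -- maximal involution: every cyclic subgroup ⟨y⟩ containing x equals ⟨x⟩
  -- (x ∈ ⟨y⟩ forces y ∈ ⟨x⟩, hence ⟨y⟩ = ⟨x⟩)
  IsMaximalInvolution : Fin n → Set
  IsMaximalInvolution x = IsInvolution x × (∀ y → IsPowerOf x y → IsPowerOf y x)

  -- an edge colouring with colours Fin k: a symmetric function on pairs of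
  -- vertices (only its values on edges of Γ_G matter)
  record EdgeColouring (k : ℕ) : Set where
    field
      colour : Fin n → Fin n → Fin k
      sym    : ∀ x y → colour x y ≡ colour y x
  open EdgeColouring public

  data Walk {k : ℕ} (c : EdgeColouring k) : Fin n → Fin n → List (Fin k) → Set where
    here : ∀ {x} → Walk c x x []
    step : ∀ {x y z cs} → Adj x y → Walk c y z cs → Walk c x z (colour c x y ∷ cs)

  -- a rainbow k-colouring: any two vertices are joined by a walk whose edges
  -- have pairwise distinct colours (a rainbow walk contains a rainbow path)
  IsRainbow : {k : ℕ} → EdgeColouring k → Set
  IsRainbow c = ∀ x y → ∃ λ cs → Walk c x y cs × Unique cs

  HasRainbowColouring : ℕ → Set
  HasRainbowColouring k = Σ (EdgeColouring k) IsRainbow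

  RainbowConnectionNumber : ℕ → Set
  RainbowConnectionNumber r = HasRainbowColouring r × (∀ k → k < r → ¬ HasRainbowColouring k)

-- A maximal involution x is a pendant vertex of Γ_G: its only neighbour is e.  A rainbow path
-- between two maximal involutions therefore starts and ends with spokes (edges at e), and these
-- get distinct colours, so rc(Γ_G) ≥ |M_G|.  Two colours never suffice once M_G ≠ ∅: for
-- |G| ≥ 3 there is an involution y ≠ x, and each pair among x, y, xy is joined only through e,
-- so the three spokes to x, y, xy are pairwise differently coloured.  (If x were the only
-- involution it would be central, and any g ∉ {e, x} would give x ∈ ⟨g⟩ when g has even order
-- and x = (xg)^q when g^q = e with q odd; both contradict maximality.)
--
-- For the upper bound colour the spoke to the i-th maximal involution by i, any other spoke e–v
-- by whether v⁻¹ < v, and all remaining edges by a third colour.  Two vertices whose spokes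
-- share a colour are not both maximal, and a non-maximal vertex r ≠ e lies in a cyclic group
-- ⟨y⟩ of order > 2; one of its generators y, y⁻¹ is a neighbour of r whose spoke has the other
-- side-colour, giving a rainbow path of length 3 through e.
module Submission where

open import Defs
open import Data.Nat using (ℕ; zero; suc; _+_; _*_; _∸_; _≤_; _<_; z≤n; s≤s; s≤s⁻¹)
import Data.Nat.Properties as ℕ
open import Data.Nat.DivMod using (_%_; _/_; m≡m%n+[m/n]*n; m%n<n)
open import Data.Nat.Induction using (<-wellFounded)
open import Induction.WellFounded using (Acc; acc)
open import Data.Bool using (Bool; true; false)
open import Data.Bool.Properties using () renaming (_≟_ to _≟ᵇ_)
open import Data.Fin as Fin using (Fin; zero; suc; toℕ; fromℕ<; inject≤)
import Data.Fin.Properties as Finₚ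
open Finₚ using (_≟_)
open import Data.Product using (∃; _×_; _,_; proj₁; proj₂; -,_)
open import Data.Sum using (_⊎_; inj₁; inj₂; [_,_]′; swap)
open import Data.Empty using (⊥-elim)
open import Data.List using (List; []; _∷_; length; lookup)
open import Data.List.Membership.Propositional using (_∈_)
open import Data.List.Membership.Propositional.Properties using (∈-lookup)
import Data.List.Relation.Unary.All as All
open import Data.List.Relation.Unary.Any using (here; there)
open import Data.List.Relation.Unary.AllPairs using ([]; _∷_)
open import Data.List.Relation.Unary.Unique.Propositional using (Unique)
open import Relation.Nullary using (¬_; Dec; yes; no; does; contradiction)
open import Relation.Nullary.Decidable
  using (_×-dec_; _→-dec_; ¬?; map′; decidable-stable; dec-true; dec-false)
open import Relation.Binary.Definitions using (tri<; tri≈; tri>)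
open import Relation.Binary.PropositionalEquality
  using (_≡_; _≢_; refl; sym; trans; cong; cong₂; subst; module ≡-Reasoning)
open import Function using (_∘_)
open import Function.Definitions using (Injective)
open import Algebra.Core using (Op₁; Op₂)
open import Algebra.Bundles using (Group)
open import Algebra.Structures using (IsGroup)
import Algebra.Properties.Group as GroupProperties
import Algebra.Properties.Monoid.Mult as MonoidMult

unique₃ : ∀ {A : Set} {a b c : A} → a ≢ b → a ≢ c → b ≢ c → Unique (a ∷ b ∷ c ∷ [])
unique₃ a≢b a≢c b≢c = (a≢b All.∷ a≢c All.∷ All.[]) ∷ (b≢c All.∷ All.[]) ∷ All.[] ∷ []

unique₃-resp : ∀ {A : Set} {a a′ b b′ c c′ : A} → a ≡ a′ → b ≡ b′ → c ≡ c′ →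
               Unique (a′ ∷ b′ ∷ c′ ∷ []) → Unique (a ∷ b ∷ c ∷ [])
unique₃-resp refl refl refl distinct = distinct

Unique⇒lookup-injective : ∀ {A : Set} {xs : List A} → Unique xs → Injective _≡_ _≡_ (lookup xs)
Unique⇒lookup-injective (_ ∷ _) {zero} {zero} _ = refl
Unique⇒lookup-injective (x∉xs ∷ _) {zero} {suc j} x≡xⱼ =
  contradiction x≡xⱼ (All.lookup x∉xs (∈-lookup j))
Unique⇒lookup-injective (x∉xs ∷ _) {suc i} {zero} xᵢ≡x =
  contradiction (sym xᵢ≡x) (All.lookup x∉xs (∈-lookup i))
Unique⇒lookup-injective (_ ∷ xs-unique) {suc i} {suc j} xᵢ≡xⱼ =
  cong suc (Unique⇒lookup-injective xs-unique xᵢ≡xⱼ)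

Unique⇒length≤ : ∀ {k} {cs : List (Fin k)} → Unique cs → length cs ≤ k
Unique⇒length≤ cs-unique = Finₚ.injective⇒≤ (Unique⇒lookup-injective cs-unique)

¬Unique₃-Fin≤2 : ∀ {k} → k ≤ 2 → ∀ {a b c : Fin k} {cs} → ¬ Unique (a ∷ b ∷ c ∷ cs)
¬Unique₃-Fin≤2 k≤2 distinct =
  ℕ.≤⇒≯ k≤2 (ℕ.≤-trans (s≤s (s≤s (s≤s z≤n))) (Unique⇒length≤ distinct))

∃-avoiding₂ : ∀ {N} → 3 ≤ N → (a b : Fin N) → ∃ λ g → g ≢ a × g ≢ b
∃-avoiding₂ (s≤s (s≤s (s≤s _))) zero          zero          = suc zero , (λ ()) , (λ ())
∃-avoiding₂ (s≤s (s≤s (s≤s _))) zero          (suc zero)    = suc (suc zero) , (λ ()) , (λ ())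
∃-avoiding₂ (s≤s (s≤s (s≤s _))) zero          (suc (suc _)) = suc zero , (λ ()) , (λ ())
∃-avoiding₂ (s≤s (s≤s (s≤s _))) (suc zero)    zero          = suc (suc zero) , (λ ()) , (λ ())
∃-avoiding₂ (s≤s (s≤s (s≤s _))) (suc (suc _)) zero          = suc zero , (λ ()) , (λ ())
∃-avoiding₂ (s≤s (s≤s (s≤s _))) (suc _)       (suc _)       = zero , (λ ()) , (λ ())

even-or-odd : ∀ q → ∃ λ s → q ≡ s + s ⊎ q ≡ suc (s + s)
even-or-odd zero = 0 , inj₁ refl
even-or-odd (suc q) with even-or-odd q
... | s , inj₁ q≡s+s   = s , inj₂ (cong suc q≡s+s)
... | s , inj₂ q≡1+s+s = suc s , inj₁ (cong suc (trans q≡1+s+s (sym (ℕ.+-suc s s))))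

module _ {n : ℕ} {_·_ : Op₂ (Fin n)} {e : Fin n} {inv : Op₁ (Fin n)}
         (isGroup : IsGroup _≡_ _·_ e inv) where

  -- The bundle is rebuilt only to get _∙_ and _⁻¹ with their usual fixities.
  group : Group _ _
  group = record
    { Carrier = Fin n ; _≈_ = _≡_ ; _∙_ = _·_ ; ε = e ; _⁻¹ = inv ; isGroup = isGroup }

  open Group group using (_∙_; ε; _⁻¹; assoc; identityˡ; identityʳ; inverseʳ)
  open GroupProperties group
    using (∙-cancelˡ; inverseʳ-unique; identityˡ-unique; identityʳ-unique; ⁻¹-involutive; ε⁻¹≈ε;
           ⁻¹-injective; ⁻¹-anti-homo-∙; x∙y⁻¹≈ε⇒x≈y; \\-leftDividesʳ; //-rightDividesˡ)
  open MonoidMult (Group.monoid group) using (×-homo-+; ×-assocˡ) renaming (_×_ to _×ᵐ_)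
  open PowerGraph _∙_ ε renaming (sym to colour-sym)
  open ≡-Reasoning

  pow-ε : ∀ k → pow ε k ≡ ε
  pow-ε zero    = refl
  pow-ε (suc k) = trans (identityˡ _) (pow-ε k)

  pow≡× : ∀ y k → pow y k ≡ k ×ᵐ y
  pow≡× y zero    = refl
  pow≡× y (suc k) = cong (y ∙_) (pow≡× y k)

  pow-homo-+ : ∀ y i j → pow y (i + j) ≡ pow y i ∙ pow y j
  pow-homo-+ y i j rewrite pow≡× y (i + j) | pow≡× y i | pow≡× y j = ×-homo-+ y i j

  pow-pow : ∀ y i j → pow (pow y i) j ≡ pow y (j * i)
  pow-pow y i j rewrite pow≡× (pow y i) j | pow≡× y i | pow≡× y (j * i) = ×-assocˡ y j i

  pow-multiple : ∀ g P → pow g P ≡ ε → ∀ q → pow g (q * P) ≡ ε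
  pow-multiple g P gᴾ≡ε q = begin
    pow g (q * P)   ≡⟨ pow-pow g P q ⟨
    pow (pow g P) q ≡⟨ cong (λ h → pow h q) gᴾ≡ε ⟩
    pow ε q         ≡⟨ pow-ε q ⟩
    ε               ∎

  period : ∀ g → ∃ λ p → pow g (suc p) ≡ ε
  period g with Finₚ.pigeonhole (ℕ.n<1+n n) (λ (t : Fin (suc n)) → pow g (toℕ t))
  ... | i , j , i<j , gⁱ≡gʲ = p , ∙-cancelˡ (pow g (toℕ i)) _ _ (begin
      pow g (toℕ i) ∙ pow g (suc p) ≡⟨ pow-homo-+ g (toℕ i) (suc p) ⟨
      pow g (toℕ i + suc p)         ≡⟨ cong (pow g) i+1+p≡j ⟩
      pow g (toℕ j)                 ≡⟨ gⁱ≡gʲ ⟨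
      pow g (toℕ i)                 ≡⟨ identityʳ _ ⟨
      pow g (toℕ i) ∙ ε             ∎)
    where
      p : ℕ
      p = toℕ j ∸ suc (toℕ i)
      i+1+p≡j : toℕ i + suc p ≡ toℕ j
      i+1+p≡j = trans (ℕ.+-suc (toℕ i) p) (ℕ.m+[n∸m]≡n i<j)

  pow-mod : ∀ g p → pow g (suc p) ≡ ε → ∀ k → pow g k ≡ pow g (k % suc p)
  pow-mod g p gᴾ≡ε k = begin
    pow g k                                       ≡⟨ cong (pow g) (m≡m%n+[m/n]*n k (suc p)) ⟩
    pow g (k % suc p + k / suc p * suc p)         ≡⟨ pow-homo-+ g (k % suc p) _ ⟩
    pow g (k % suc p) ∙ pow g (k / suc p * suc p) ≡⟨ cong (pow g (k % suc p) ∙_) multiple-vanishes ⟩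
    pow g (k % suc p) ∙ ε                         ≡⟨ identityʳ _ ⟩
    pow g (k % suc p)                             ∎
    where
      multiple-vanishes : pow g (k / suc p * suc p) ≡ ε
      multiple-vanishes = pow-multiple g (suc p) gᴾ≡ε (k / suc p)

  IsPowerOf-refl : ∀ g → IsPowerOf g g
  IsPowerOf-refl g = 1 , sym (identityʳ g)

  IsPowerOf-trans : ∀ {a b g} → IsPowerOf a b → IsPowerOf b g → IsPowerOf a g
  IsPowerOf-trans {g = g} (i , a≡bⁱ) (j , b≡gʲ) =
    i * j , trans a≡bⁱ (trans (cong (λ h → pow h i) b≡gʲ) (pow-pow g j i))

  IsPowerOf-∙ : ∀ {a b g} → IsPowerOf a g → IsPowerOf b g → IsPowerOf (a ∙ b) g
  IsPowerOf-∙ {g = g} (i , a≡gⁱ) (j , b≡gʲ) =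
    i + j , trans (cong₂ _∙_ a≡gⁱ b≡gʲ) (sym (pow-homo-+ g i j))

  IsPowerOf-ε : ∀ {a} → IsPowerOf a ε → a ≡ ε
  IsPowerOf-ε (k , a≡εᵏ) = trans a≡εᵏ (pow-ε k)

  IsPowerOf? : ∀ a g → Dec (IsPowerOf a g)
  IsPowerOf? a g with period g
  ... | p , gᴾ≡ε =
    map′ (λ (t , a≡gᵗ) → toℕ t , a≡gᵗ) reduce (Finₚ.any? λ t → a ≟ pow g (toℕ t))
    where
      reduce : IsPowerOf a g → ∃ λ (t : Fin (suc p)) → a ≡ pow g (toℕ t)
      reduce (k , a≡gᵏ) = fromℕ< k%P<P , trans a≡gᵏ
        (trans (pow-mod g p gᴾ≡ε k) (cong (pow g) (sym (Finₚ.toℕ-fromℕ< k%P<P))))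
        where
          k%P<P : k % suc p < suc p
          k%P<P = m%n<n k (suc p)

  ⁻¹-IsPowerOf : ∀ g → IsPowerOf (g ⁻¹) g
  ⁻¹-IsPowerOf g with period g
  ... | p , gᴾ≡ε = p , sym (inverseʳ-unique g (pow g p) gᴾ≡ε)

  IsPowerOf-⁻¹ : ∀ {a g} → IsPowerOf a g → IsPowerOf a (g ⁻¹)
  IsPowerOf-⁻¹ {g = g} a∈⟨g⟩ =
    IsPowerOf-trans a∈⟨g⟩
      (subst (λ h → IsPowerOf h (g ⁻¹)) (⁻¹-involutive g) (⁻¹-IsPowerOf (g ⁻¹)))

  involution-pow : ∀ {x} → x ∙ x ≡ ε → ∀ k → pow x k ≡ ε ⊎ pow x k ≡ x
  involution-pow xx≡ε zero = inj₁ refl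
  involution-pow {x} xx≡ε (suc k) with involution-pow xx≡ε k
  ... | inj₁ xᵏ≡ε = inj₂ (trans (cong (x ∙_) xᵏ≡ε) (identityʳ x))
  ... | inj₂ xᵏ≡x = inj₁ (trans (cong (x ∙_) xᵏ≡x) xx≡ε)

  involution-powers : ∀ {x w} → x ∙ x ≡ ε → IsPowerOf w x → w ≡ ε ⊎ w ≡ x
  involution-powers xx≡ε (k , w≡xᵏ) with involution-pow xx≡ε k
  ... | inj₁ xᵏ≡ε = inj₁ (trans w≡xᵏ xᵏ≡ε)
  ... | inj₂ xᵏ≡x = inj₂ (trans w≡xᵏ xᵏ≡x)

  involution-pow-odd : ∀ {x} → x ∙ x ≡ ε → ∀ s → pow x (suc (s + s)) ≡ x
  involution-pow-odd {x} xx≡ε s = begin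
    x ∙ pow x (s + s)         ≡⟨ cong (x ∙_) (pow-homo-+ x s s) ⟩
    x ∙ (pow x s ∙ pow x s)   ≡⟨ cong (x ∙_) (square (involution-pow xx≡ε s)) ⟩
    x ∙ ε                     ≡⟨ identityʳ x ⟩
    x                         ∎
    where
      square : ∀ {w} → w ≡ ε ⊎ w ≡ x → w ∙ w ≡ ε
      square (inj₁ refl) = identityʳ ε
      square (inj₂ refl) = xx≡ε

  involution-rightInverse-unique : ∀ {x g} → x ∙ x ≡ ε → x ∙ g ≡ ε → g ≡ x
  involution-rightInverse-unique {x} {g} xx≡ε xg≡ε =
    trans (inverseʳ-unique x g xg≡ε) (sym (inverseʳ-unique x x xx≡ε))

  involutionPower-or-oddPeriod : ∀ g →
    (∃ λ s → IsInvolution (pow g s)) ⊎ (∃ λ s → pow g (suc (s + s)) ≡ ε)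
  involutionPower-or-oddPeriod g with period g
  ... | p , gᴾ≡ε = halve (suc p) (<-wellFounded (suc p)) (s≤s z≤n) gᴾ≡ε
    where
      halve : ∀ q → Acc _<_ q → 0 < q → pow g q ≡ ε →
              (∃ λ s → IsInvolution (pow g s)) ⊎ (∃ λ s → pow g (suc (s + s)) ≡ ε)
      halve q (acc smaller) 0<q gᵠ≡ε with even-or-odd q
      ... | s , inj₂ refl = inj₂ (s , gᵠ≡ε)
      ... | zero , inj₁ refl = contradiction 0<q λ ()
      ... | s@(suc _) , inj₁ refl with pow g s ≟ ε
      ...   | yes gˢ≡ε = halve s (smaller (ℕ.m<m+n s (s≤s z≤n))) (s≤s z≤n) gˢ≡ε
      ...   | no gˢ≢ε  = inj₁ (s , gˢ≢ε , trans (sym (pow-homo-+ g s s)) gᵠ≡ε)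

  Central : Fin n → Set
  Central x = ∀ h → h ∙ x ≡ x ∙ h

  conjugate-involution : ∀ h {x} → IsInvolution x → IsInvolution (h ∙ x ∙ h ⁻¹)
  conjugate-involution h {x} (x≢ε , xx≡ε) = hxh⁻¹≢ε , hxh⁻¹-squared
    where
      hxh⁻¹≢ε : h ∙ x ∙ h ⁻¹ ≢ ε
      hxh⁻¹≢ε hxh⁻¹≡ε = x≢ε (identityʳ-unique h x (x∙y⁻¹≈ε⇒x≈y (h ∙ x) h hxh⁻¹≡ε))
      hxh⁻¹-squared : (h ∙ x ∙ h ⁻¹) ∙ (h ∙ x ∙ h ⁻¹) ≡ ε
      hxh⁻¹-squared = begin
        (h ∙ x ∙ h ⁻¹) ∙ (h ∙ x ∙ h ⁻¹) ≡⟨ assoc (h ∙ x) (h ⁻¹) _ ⟩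
        h ∙ x ∙ (h ⁻¹ ∙ (h ∙ x ∙ h ⁻¹)) ≡⟨ cong (h ∙ x ∙_) (assoc (h ⁻¹) (h ∙ x) (h ⁻¹)) ⟨
        h ∙ x ∙ (h ⁻¹ ∙ (h ∙ x) ∙ h ⁻¹) ≡⟨ cong (λ t → h ∙ x ∙ (t ∙ h ⁻¹)) (\\-leftDividesʳ h x) ⟩
        h ∙ x ∙ (x ∙ h ⁻¹)             ≡⟨ assoc (h ∙ x) x (h ⁻¹) ⟨
        h ∙ x ∙ x ∙ h ⁻¹               ≡⟨ cong (_∙ h ⁻¹) (trans (assoc h x x) (cong (h ∙_) xx≡ε)) ⟩
        h ∙ ε ∙ h ⁻¹                   ≡⟨ cong (_∙ h ⁻¹) (identityʳ h) ⟩
        h ∙ h ⁻¹                       ≡⟨ inverseʳ h ⟩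
        ε                              ∎

  uniqueInvolution-central : ∀ {x} → IsInvolution x → (∀ y → IsInvolution y → y ≡ x) → Central x
  uniqueInvolution-central {x} x-involution unique h = begin
    h ∙ x            ≡⟨ //-rightDividesˡ h (h ∙ x) ⟨
    h ∙ x ∙ h ⁻¹ ∙ h ≡⟨ cong (_∙ h) (unique _ (conjugate-involution h x-involution)) ⟩
    x ∙ h            ∎

  Central-pow : ∀ {a} → Central a → ∀ k → Central (pow a k)
  Central-pow a-central zero    h = trans (identityʳ h) (sym (identityˡ h))
  Central-pow {a} a-central (suc k) h = begin
    h ∙ (a ∙ pow a k) ≡⟨ assoc h a _ ⟨
    h ∙ a ∙ pow a k   ≡⟨ cong (_∙ pow a k) (a-central h) ⟩
    a ∙ h ∙ pow a k   ≡⟨ assoc a h _ ⟩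
    a ∙ (h ∙ pow a k) ≡⟨ cong (a ∙_) (Central-pow a-central k h) ⟩
    a ∙ (pow a k ∙ h) ≡⟨ assoc a _ h ⟨
    a ∙ pow a k ∙ h   ∎

  pow-∙-central : ∀ {a} → Central a → ∀ b k → pow (a ∙ b) k ≡ pow a k ∙ pow b k
  pow-∙-central a-central b zero = sym (identityˡ ε)
  pow-∙-central {a} a-central b (suc k) = begin
    a ∙ b ∙ pow (a ∙ b) k         ≡⟨ cong (a ∙ b ∙_) (pow-∙-central a-central b k) ⟩
    a ∙ b ∙ (pow a k ∙ pow b k)   ≡⟨ assoc a b _ ⟩
    a ∙ (b ∙ (pow a k ∙ pow b k)) ≡⟨ cong (a ∙_) (assoc b (pow a k) (pow b k)) ⟨
    a ∙ (b ∙ pow a k ∙ pow b k)   ≡⟨ cong (λ t → a ∙ (t ∙ pow b k)) (Central-pow a-central k b) ⟩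
    a ∙ (pow a k ∙ b ∙ pow b k)   ≡⟨ cong (a ∙_) (assoc (pow a k) b (pow b k)) ⟩
    a ∙ (pow a k ∙ (b ∙ pow b k)) ≡⟨ assoc a (pow a k) _ ⟨
    a ∙ pow a k ∙ (b ∙ pow b k)   ∎

  IsInvolution? : ∀ x → Dec (IsInvolution x)
  IsInvolution? x = ¬? (x ≟ ε) ×-dec (x ∙ x ≟ ε)

  IsMaximalInvolution? : ∀ x → Dec (IsMaximalInvolution x)
  IsMaximalInvolution? x =
    IsInvolution? x ×-dec Finₚ.all? (λ y → IsPowerOf? x y →-dec IsPowerOf? y x)

  maximalInvolution-generators : ∀ {x w} → IsMaximalInvolution x → IsPowerOf x w → w ≡ ε ⊎ w ≡ x
  maximalInvolution-generators ((_ , xx≡ε) , maximal) x∈⟨w⟩ =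
    involution-powers xx≡ε (maximal _ x∈⟨w⟩)

  maximalInvolution-pendant : ∀ {x w} → IsMaximalInvolution x → Adj x w → w ≡ ε
  maximalInvolution-pendant mx@((_ , xx≡ε) , _) (x≢w , x~w)
    with [ maximalInvolution-generators mx , involution-powers xx≡ε ]′ x~w
  ... | inj₁ w≡ε = w≡ε
  ... | inj₂ w≡x = contradiction (sym w≡x) x≢w

  Adj-sym : ∀ {a b} → Adj a b → Adj b a
  Adj-sym (a≢b , a~b) = a≢b ∘ sym , swap a~b

  ε-Adj : ∀ {v} → v ≢ ε → Adj ε v
  ε-Adj v≢ε = v≢ε ∘ sym , inj₁ (0 , refl)

  Adj-ε : ∀ {v} → v ≢ ε → Adj v ε
  Adj-ε v≢ε = Adj-sym (ε-Adj v≢ε)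

  HasOrder>2 : Fin n → Set
  HasOrder>2 y = y ≢ ε × y ∙ y ≢ ε

  HasOrder>2⇒¬maximal : ∀ {y} → HasOrder>2 y → ¬ IsMaximalInvolution y
  HasOrder>2⇒¬maximal (_ , yy≢ε) ((_ , yy≡ε) , _) = yy≢ε yy≡ε

  ⁻¹≡ε⇒≡ε : ∀ {a} → a ⁻¹ ≡ ε → a ≡ ε
  ⁻¹≡ε⇒≡ε a⁻¹≡ε = ⁻¹-injective (trans a⁻¹≡ε (sym ε⁻¹≈ε))

  HasOrder>2-⁻¹ : ∀ {y} → HasOrder>2 y → HasOrder>2 (y ⁻¹)
  HasOrder>2-⁻¹ {y} (y≢ε , yy≢ε) =
    y≢ε ∘ ⁻¹≡ε⇒≡ε , λ y⁻¹y⁻¹≡ε → yy≢ε (⁻¹≡ε⇒≡ε (trans (⁻¹-anti-homo-∙ y y) y⁻¹y⁻¹≡ε))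

  HasOrder>2⇒⁻¹≢ : ∀ {y} → HasOrder>2 y → y ⁻¹ ≢ y
  HasOrder>2⇒⁻¹≢ {y} (_ , yy≢ε) y⁻¹≡y = yy≢ε (trans (cong (y ∙_) (sym y⁻¹≡y)) (inverseʳ y))

  nonMaximal⇒inCyclicOfOrder>2 : ∀ {r} → r ≢ ε → ¬ IsMaximalInvolution r →
                                 ∃ λ y → IsPowerOf r y × HasOrder>2 y
  nonMaximal⇒inCyclicOfOrder>2 {r} r≢ε ¬maximal with r ∙ r ≟ ε
  ... | no rr≢ε = r , IsPowerOf-refl r , r≢ε , rr≢ε
  ... | yes rr≡ε
    with Finₚ.¬∀⟶∃¬ n _ (λ y → IsPowerOf? r y →-dec IsPowerOf? y r) (¬maximal ∘ ((r≢ε , rr≡ε) ,_))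
  ...   | y , ¬[r∈⟨y⟩⇒y∈⟨r⟩] = y , r∈⟨y⟩ , y≢ε , yy≢ε
    where
      r∈⟨y⟩ : IsPowerOf r y
      r∈⟨y⟩ = decidable-stable (IsPowerOf? r y) λ r∉⟨y⟩ → ¬[r∈⟨y⟩⇒y∈⟨r⟩] (⊥-elim ∘ r∉⟨y⟩)
      y∉⟨r⟩ : ¬ IsPowerOf y r
      y∉⟨r⟩ y∈⟨r⟩ = ¬[r∈⟨y⟩⇒y∈⟨r⟩] λ _ → y∈⟨r⟩
      y≢ε : y ≢ ε
      y≢ε y≡ε = r≢ε (IsPowerOf-ε (subst (IsPowerOf r) y≡ε r∈⟨y⟩))
      yy≢ε : y ∙ y ≢ ε
      yy≢ε yy≡ε with involution-powers yy≡ε r∈⟨y⟩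
      ... | inj₁ r≡ε = r≢ε r≡ε
      ... | inj₂ r≡y = y∉⟨r⟩ (subst (IsPowerOf y) (sym r≡y) (IsPowerOf-refl y))

  side : Fin n → Bool
  side v = does (v ⁻¹ Finₚ.<? v)

  side-⁻¹-< : ∀ {v} → v ⁻¹ Fin.< v → side (v ⁻¹) ≢ side v
  side-⁻¹-< {v} v⁻¹<v same =
    contradiction (trans (sym side[v⁻¹]≡false) (trans same side[v]≡true)) λ ()
    where
      side[v]≡true : side v ≡ true
      side[v]≡true = dec-true (v ⁻¹ Finₚ.<? v) v⁻¹<v
      side[v⁻¹]≡false : side (v ⁻¹) ≡ false
      side[v⁻¹]≡false = dec-false ((v ⁻¹) ⁻¹ Finₚ.<? v ⁻¹)
        (Finₚ.<-asym v⁻¹<v ∘ subst (Fin._< v ⁻¹) (⁻¹-involutive v))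

  side-⁻¹ : ∀ {v} → v ⁻¹ ≢ v → side (v ⁻¹) ≢ side v
  side-⁻¹ {v} v⁻¹≢v with Finₚ.<-cmp (v ⁻¹) v
  ... | tri< v⁻¹<v _ _ = side-⁻¹-< v⁻¹<v
  ... | tri≈ _ v⁻¹≡v _ = contradiction v⁻¹≡v v⁻¹≢v
  ... | tri> _ _ v<v⁻¹ = λ same →
    side-⁻¹-< (subst (Fin._< v ⁻¹) (sym (⁻¹-involutive v)) v<v⁻¹)
              (trans (cong side (⁻¹-involutive v)) (sym same))

  partner : ∀ {r} → r ≢ ε → ¬ IsMaximalInvolution r →
            ∃ λ w → Adj r w × HasOrder>2 w × side w ≢ side r
  partner {r} r≢ε ¬maximal with nonMaximal⇒inCyclicOfOrder>2 r≢ε ¬maximal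
  ... | y , r∈⟨y⟩ , y>2 with side y ≟ᵇ side r
  ...   | no sides≢ = y , (sides≢ ∘ cong side ∘ sym , inj₁ r∈⟨y⟩) , y>2 , sides≢
  ...   | yes sides≡ =
    y ⁻¹ , (sides≢ ∘ cong side ∘ sym , inj₁ (IsPowerOf-⁻¹ r∈⟨y⟩)) , HasOrder>2-⁻¹ y>2 , sides≢
    where
      sides≢ : side (y ⁻¹) ≢ side r
      sides≢ same = side-⁻¹ (HasOrder>2⇒⁻¹≢ y>2) (trans same (sym sides≡))

  module SpokeColouring {m k : ℕ} (f : Fin m → Fin n) (f-injective : Injective _≡_ _≡_ f)
                        (f-onto : ∀ x → IsMaximalInvolution x → ∃ λ i → f i ≡ x)
                        (m≤3+k : m ≤ 3 + k) where

    sideColour : Bool → Fin (3 + k)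
    sideColour false = zero
    sideColour true  = suc zero

    rimColour : Fin (3 + k)
    rimColour = suc (suc zero)

    sideColour-injective : ∀ {b b′} → sideColour b ≡ sideColour b′ → b ≡ b′
    sideColour-injective {false} {false} _ = refl
    sideColour-injective {true}  {true}  _ = refl
    sideColour-injective {false} {true}  ()
    sideColour-injective {true}  {false} ()

    sideColour≢rimColour : ∀ b → sideColour b ≢ rimColour
    sideColour≢rimColour false ()
    sideColour≢rimColour true  ()

    -- Opaque because unfolding the decision procedure IsMaximalInvolution? (which runs through
    -- all of Fin n) makes with-abstraction and conversion checking elsewhere unusably slow.
    opaque
      spokeColour : Fin n → Fin (3 + k)
      spokeColour v with IsMaximalInvolution? v
      ... | yes mv = inject≤ (proj₁ (f-onto v mv)) m≤3+k
      ... | no _   = sideColour (side v)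

      spokeColour-nonMaximal : ∀ {v} → ¬ IsMaximalInvolution v →
                               spokeColour v ≡ sideColour (side v)
      spokeColour-nonMaximal {v} ¬mv with IsMaximalInvolution? v
      ... | yes mv = contradiction mv ¬mv
      ... | no _   = refl

      spokeColour-maximal-injective : ∀ {x y} → IsMaximalInvolution x → IsMaximalInvolution y →
                                      spokeColour x ≡ spokeColour y → x ≡ y
      spokeColour-maximal-injective {x} {y} mx my
        with IsMaximalInvolution? x | IsMaximalInvolution? y
      ... | yes mx′ | yes my′ = λ same →
        let (i , fi≡x) = f-onto x mx′ ; (j , fj≡y) = f-onto y my′
        in trans (sym fi≡x) (trans (cong f (Finₚ.inject≤-injective _ _ i j same)) fj≡y)
      ... | no ¬mx | _      = contradiction mx ¬mx
      ... | _      | no ¬my = contradiction my ¬my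

    spokeOrRim : ∀ {u v} → Dec (u ≡ ε) → Dec (v ≡ ε) → Fin (3 + k)
    spokeOrRim {v = v} (yes _) _       = spokeColour v
    spokeOrRim {u}     (no _)  (yes _) = spokeColour u
    spokeOrRim         (no _)  (no _)  = rimColour

    edgeColour : Fin n → Fin n → Fin (3 + k)
    edgeColour u v = spokeOrRim (u ≟ ε) (v ≟ ε)

    spokeOrRim-left : ∀ {u v} → u ≡ ε → (u≟ε : Dec (u ≡ ε)) (v≟ε : Dec (v ≡ ε)) →
                      spokeOrRim u≟ε v≟ε ≡ spokeColour v
    spokeOrRim-left _   (yes _)   _ = refl
    spokeOrRim-left u≡ε (no u≢ε) _ = contradiction u≡ε u≢ε

    spokeOrRim-right : ∀ {u v} → v ≡ ε → (u≟ε : Dec (u ≡ ε)) (v≟ε : Dec (v ≡ ε)) →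
                       spokeOrRim u≟ε v≟ε ≡ spokeColour u
    spokeOrRim-right v≡ε (yes u≡ε) _         = cong spokeColour (trans v≡ε (sym u≡ε))
    spokeOrRim-right _   (no _)    (yes _)   = refl
    spokeOrRim-right v≡ε (no _)    (no v≢ε) = contradiction v≡ε v≢ε

    spokeOrRim-rim : ∀ {u v} → u ≢ ε → v ≢ ε → (u≟ε : Dec (u ≡ ε)) (v≟ε : Dec (v ≡ ε)) →
                     spokeOrRim u≟ε v≟ε ≡ rimColour
    spokeOrRim-rim u≢ε _   (yes u≡ε) _         = contradiction u≡ε u≢ε
    spokeOrRim-rim _   v≢ε (no _)    (yes v≡ε) = contradiction v≡ε v≢ε
    spokeOrRim-rim _   _   (no _)    (no _)    = refl

    spokeOrRim-sym : ∀ {u v} (u≟ε : Dec (u ≡ ε)) (v≟ε : Dec (v ≡ ε)) →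
                     spokeOrRim u≟ε v≟ε ≡ spokeOrRim v≟ε u≟ε
    spokeOrRim-sym (yes u≡ε) (yes v≡ε) = cong spokeColour (trans v≡ε (sym u≡ε))
    spokeOrRim-sym (yes _)   (no _)    = refl
    spokeOrRim-sym (no _)    (yes _)   = refl
    spokeOrRim-sym (no _)    (no _)    = refl

    edgeColour-ε-left : ∀ v → edgeColour ε v ≡ spokeColour v
    edgeColour-ε-left v = spokeOrRim-left refl (ε ≟ ε) (v ≟ ε)

    edgeColour-ε-right : ∀ u → edgeColour u ε ≡ spokeColour u
    edgeColour-ε-right u = spokeOrRim-right refl (u ≟ ε) (ε ≟ ε)

    edgeColour-rim : ∀ {u v} → u ≢ ε → v ≢ ε → edgeColour u v ≡ rimColour
    edgeColour-rim {u} {v} u≢ε v≢ε = spokeOrRim-rim u≢ε v≢ε (u ≟ ε) (v ≟ ε)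

    edgeColour-sym : ∀ u v → edgeColour u v ≡ edgeColour v u
    edgeColour-sym u v = spokeOrRim-sym (u ≟ ε) (v ≟ ε)

    colouring : EdgeColouring (3 + k)
    colouring = record { colour = edgeColour ; sym = edgeColour-sym }

    RainbowWalk : Fin n → Fin n → Set
    RainbowWalk x y = ∃ λ cs → Walk colouring x y cs × Unique cs

    viaHub : ∀ {x y} → x ≢ ε → y ≢ ε → spokeColour x ≢ spokeColour y → RainbowWalk x y
    viaHub {x} {y} x≢ε y≢ε spokes≢ =
      -, step (Adj-ε x≢ε) (step (ε-Adj y≢ε) here) , (distinct All.∷ All.[]) ∷ All.[] ∷ []
      where
        distinct : edgeColour x ε ≢ edgeColour ε y
        distinct same =
          spokes≢ (trans (sym (edgeColour-ε-right x)) (trans same (edgeColour-ε-left y)))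

    detourFrom : ∀ {x y} → x ≢ ε → y ≢ ε → ¬ IsMaximalInvolution x →
                 spokeColour x ≡ spokeColour y → RainbowWalk x y
    detourFrom {x} {y} x≢ε y≢ε ¬mx spokes≡ with partner x≢ε ¬mx
    ... | w , x~w , w>2@(w≢ε , _) , sides≢ =
      -, step x~w (step (Adj-ε w≢ε) (step (ε-Adj y≢ε) here)) ,
      unique₃-resp (edgeColour-rim x≢ε w≢ε)
        (trans (edgeColour-ε-right w) (spokeColour-nonMaximal (HasOrder>2⇒¬maximal w>2)))
        (trans (edgeColour-ε-left y) (trans (sym spokes≡) (spokeColour-nonMaximal ¬mx)))
        (unique₃ (sideColour≢rimColour _ ∘ sym) (sideColour≢rimColour _ ∘ sym)
                 (sides≢ ∘ sideColour-injective))

    detourTo : ∀ {x y} → x ≢ ε → y ≢ ε → ¬ IsMaximalInvolution y →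
               spokeColour x ≡ spokeColour y → RainbowWalk x y
    detourTo {x} {y} x≢ε y≢ε ¬my spokes≡ with partner y≢ε ¬my
    ... | w , y~w , w>2@(w≢ε , _) , sides≢ =
      -, step (Adj-ε x≢ε) (step (ε-Adj w≢ε) (step (Adj-sym y~w) here)) ,
      unique₃-resp (trans (edgeColour-ε-right x) (trans spokes≡ (spokeColour-nonMaximal ¬my)))
        (trans (edgeColour-ε-left w) (spokeColour-nonMaximal (HasOrder>2⇒¬maximal w>2)))
        (edgeColour-rim w≢ε y≢ε)
        (unique₃ (sides≢ ∘ sym ∘ sideColour-injective) (sideColour≢rimColour _)
                 (sideColour≢rimColour _))

    sameSpoke : ∀ {x y} → x ≢ y → x ≢ ε → y ≢ ε → spokeColour x ≡ spokeColour y →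
                Dec (IsMaximalInvolution x) → Dec (IsMaximalInvolution y) → RainbowWalk x y
    sameSpoke x≢y _   _   spokes≡ (yes mx) (yes my) =
      contradiction (spokeColour-maximal-injective mx my spokes≡) x≢y
    sameSpoke _   x≢ε y≢ε spokes≡ (no ¬mx) _        = detourFrom x≢ε y≢ε ¬mx spokes≡
    sameSpoke _   x≢ε y≢ε spokes≡ (yes _)  (no ¬my) = detourTo x≢ε y≢ε ¬my spokes≡

    rainbow : IsRainbow colouring
    rainbow x y with x ≟ y
    ... | yes refl = [] , here , []
    ... | no x≢y with x ≟ ε | y ≟ ε
    ...   | yes refl | _        = -, step (ε-Adj (x≢y ∘ sym)) here , All.[] ∷ []
    ...   | no _     | yes refl = -, step (Adj-ε x≢y) here , All.[] ∷ []
    ...   | no x≢ε   | no y≢ε with spokeColour x ≟ spokeColour y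
    ...     | no spokes≢ = viaHub x≢ε y≢ε spokes≢
    ...     | yes spokes≡ =
      sameSpoke x≢y x≢ε y≢ε spokes≡ (IsMaximalInvolution? x) (IsMaximalInvolution? y)

  hasRainbowColouring : ∀ {m k} → HasSize IsMaximalInvolution m → m ≤ 3 + k →
                        HasRainbowColouring (3 + k)
  hasRainbowColouring (f , f-injective , f-image) m≤3+k = colouring , rainbow
    where open SpokeColouring f f-injective (proj₁ ∘ f-image) m≤3+k

  HubSeparated : Fin n → Fin n → Set
  HubSeparated u v = u ≢ v × ¬ Adj u v × (∀ w → Adj u w → Adj w v → w ≡ ε)

  module _ {k} {c : EdgeColouring k} where

    lastSpoke : ∀ {u y z cs} → Adj u y → Walk c y z cs → IsMaximalInvolution z →
                colour c ε z ∈ colour c u y ∷ cs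
    lastSpoke u~z here mz =
      here (cong (λ t → colour c t _) (sym (maximalInvolution-pendant mz (Adj-sym u~z))))
    lastSpoke _ (step y~y′ rest) mz = there (lastSpoke y~y′ rest mz)

    maximalSpokes-distinct : IsRainbow c → ∀ {a b} → IsMaximalInvolution a →
                             IsMaximalInvolution b → a ≢ b → colour c ε a ≢ colour c ε b
    maximalSpokes-distinct rainbow {a} {b} ma mb a≢b with rainbow a b
    ... | _ , here , _ = contradiction refl a≢b
    ... | _ , step a~b here , _ =
      contradiction (maximalInvolution-pendant ma a~b) (proj₁ (proj₁ mb))
    ... | _ , step a~y (step y~y′ rest) , first∉rest ∷ _ with maximalInvolution-pendant ma a~y
    ...   | refl = λ spokes≡ →
      All.lookup first∉rest (lastSpoke y~y′ rest mb) (trans (colour-sym c a ε) spokes≡)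

    hubSeparated⇒spokeColours≢ : k ≤ 2 → IsRainbow c → ∀ {u v} → HubSeparated u v →
                                  colour c ε u ≢ colour c ε v
    hubSeparated⇒spokeColours≢ k≤2 rainbow {u} {v} (u≢v , ¬u~v , throughHub) with rainbow u v
    ... | _ , here , _ = contradiction refl u≢v
    ... | _ , step u~v here , _ = contradiction u~v ¬u~v
    ... | _ , step _ (step _ (step _ _)) , distinct =
      contradiction distinct (¬Unique₃-Fin≤2 k≤2)
    ... | _ , step {y = w} u~w (step w~v here) , (first≢second All.∷ All.[]) ∷ _
      with throughHub w u~w w~v
    ...   | refl = λ spokes≡ → first≢second (trans (colour-sym c u ε) spokes≡)

  maximalInvolutions≤colours : ∀ {m k} → HasSize IsMaximalInvolution m → HasRainbowColouring k →
                               m ≤ k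
  maximalInvolutions≤colours (f , f-injective , f-image) (c , rainbow) =
    Finₚ.injective⇒≤ spokeColours-injective
    where
      f-maximal : ∀ i → IsMaximalInvolution (f i)
      f-maximal = proj₂ (f-image ε)
      spokeColours-injective : Injective _≡_ _≡_ (λ i → colour c ε (f i))
      spokeColours-injective {i} {j} same = decidable-stable (i ≟ j) λ i≢j →
        maximalSpokes-distinct rainbow (f-maximal i) (f-maximal j) (i≢j ∘ f-injective) same

  maximalInvolution-hubSeparated : ∀ {x y} → IsMaximalInvolution x → y ≢ ε → y ≢ x →
                                   HubSeparated x y
  maximalInvolution-hubSeparated mx y≢ε y≢x =
    y≢x ∘ sym , y≢ε ∘ maximalInvolution-pendant mx , λ w x~w _ → maximalInvolution-pendant mx x~w

  module InvolutionProduct {x y} (mx : IsMaximalInvolution x) (y-involution : IsInvolution y)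
                           (y≢x : y ≢ x) where

    private
      x≢ε : x ≢ ε
      x≢ε = proj₁ (proj₁ mx)
      xx≡ε : x ∙ x ≡ ε
      xx≡ε = proj₂ (proj₁ mx)
      y≢ε : y ≢ ε
      y≢ε = proj₁ y-involution
      yy≡ε : y ∙ y ≡ ε
      yy≡ε = proj₂ y-involution

    xy≢ε : x ∙ y ≢ ε
    xy≢ε = y≢x ∘ involution-rightInverse-unique xx≡ε

    xy≢x : x ∙ y ≢ x
    xy≢x = y≢ε ∘ identityʳ-unique x y

    generatesBoth : ∀ {w} → IsPowerOf y w → IsPowerOf (x ∙ y) w → w ≡ ε ⊎ w ≡ x
    generatesBoth y∈⟨w⟩ xy∈⟨w⟩ =
      maximalInvolution-generators mx
        (subst (λ t → IsPowerOf t _) xy·y≡x (IsPowerOf-∙ xy∈⟨w⟩ y∈⟨w⟩))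
      where
        xy·y≡x : x ∙ y ∙ y ≡ x
        xy·y≡x = trans (assoc x y y) (trans (cong (x ∙_) yy≡ε) (identityʳ x))

    y∉⟨xy⟩ : ¬ IsPowerOf y (x ∙ y)
    y∉⟨xy⟩ y∈⟨xy⟩ = [ xy≢ε , xy≢x ]′ (generatesBoth y∈⟨xy⟩ (IsPowerOf-refl _))

    xy∉⟨y⟩ : ¬ IsPowerOf (x ∙ y) y
    xy∉⟨y⟩ xy∈⟨y⟩ = [ y≢ε , y≢x ]′ (generatesBoth (IsPowerOf-refl y) xy∈⟨y⟩)

    commonNeighbour≡ε : ∀ w → Adj y w → Adj w (x ∙ y) → w ≡ ε
    commonNeighbour≡ε w (y≢w , inj₂ w∈⟨y⟩) _ with involution-powers yy≡ε w∈⟨y⟩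
    ... | inj₁ w≡ε = w≡ε
    ... | inj₂ w≡y = contradiction (sym w≡y) y≢w
    commonNeighbour≡ε w (_ , inj₁ y∈⟨w⟩) (_ , inj₁ w∈⟨xy⟩) =
      contradiction (IsPowerOf-trans y∈⟨w⟩ w∈⟨xy⟩) y∉⟨xy⟩
    commonNeighbour≡ε w (_ , inj₁ y∈⟨w⟩) (_ , inj₂ xy∈⟨w⟩) with generatesBoth y∈⟨w⟩ xy∈⟨w⟩
    ... | inj₁ w≡ε = w≡ε
    ... | inj₂ refl = ⊥-elim ([ y≢ε , y≢x ]′ (involution-powers xx≡ε y∈⟨w⟩))

    hubSeparated : HubSeparated y (x ∙ y)
    hubSeparated = y≢xy , [ y∉⟨xy⟩ , xy∉⟨y⟩ ]′ ∘ proj₂ , commonNeighbour≡ε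
      where
        y≢xy : y ≢ x ∙ y
        y≢xy y≡xy = x≢ε (identityˡ-unique x y (sym y≡xy))

  uniqueInvolution-notMaximal : 3 ≤ n → ∀ {x} → (∀ y → IsInvolution y → y ≡ x) →
                                ¬ IsMaximalInvolution x
  uniqueInvolution-notMaximal 3≤n {x} unique mx@(x-involution@(_ , xx≡ε) , _)
    with ∃-avoiding₂ 3≤n ε x
  ... | g , g≢ε , g≢x with involutionPower-or-oddPeriod g
  ...   | inj₁ (s , gˢ-involution) =
    [ g≢ε , g≢x ]′ (maximalInvolution-generators mx (s , sym (unique _ gˢ-involution)))
  ...   | inj₂ (s , gᵒ≡ε) with maximalInvolution-generators mx (suc (s + s) , sym [xg]ᵒ≡x)
    where
      [xg]ᵒ≡x : pow (x ∙ g) (suc (s + s)) ≡ x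
      [xg]ᵒ≡x = begin
        pow (x ∙ g) (suc (s + s))                 ≡⟨ pow-∙-central x-central g (suc (s + s)) ⟩
        pow x (suc (s + s)) ∙ pow g (suc (s + s)) ≡⟨ cong₂ _∙_ (involution-pow-odd xx≡ε s) gᵒ≡ε ⟩
        x ∙ ε                                     ≡⟨ identityʳ x ⟩
        x                                         ∎
        where
          x-central : Central x
          x-central = uniqueInvolution-central x-involution unique
  ...     | inj₁ xg≡ε = g≢x (involution-rightInverse-unique xx≡ε xg≡ε)
  ...     | inj₂ xg≡x = g≢ε (identityʳ-unique x g xg≡x)

  anotherInvolution : 3 ≤ n → ∀ {x} → IsMaximalInvolution x → ∃ λ y → IsInvolution y × y ≢ x
  anotherInvolution 3≤n {x} mx with Finₚ.any? (λ y → IsInvolution? y ×-dec ¬? (y ≟ x))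
  ... | yes found = found
  ... | no none   = contradiction mx (uniqueInvolution-notMaximal 3≤n λ y y-involution →
                      decidable-stable (y ≟ x) λ y≢x → none (y , y-involution , y≢x))

  noRainbowColouring≤2 : 3 ≤ n → ∀ {x k} → IsMaximalInvolution x → k ≤ 2 →
                         ¬ HasRainbowColouring k
  noRainbowColouring≤2 3≤n mx k≤2 (c , rainbow) with anotherInvolution 3≤n mx
  ... | y , y-involution@(y≢ε , _) , y≢x = ¬Unique₃-Fin≤2 k≤2 (unique₃
          (spokes≢ (maximalInvolution-hubSeparated mx y≢ε y≢x))
          (spokes≢ (maximalInvolution-hubSeparated mx xy≢ε xy≢x))
          (spokes≢ hubSeparated))
    where
      open InvolutionProduct mx y-involution y≢x
      spokes≢ : ∀ {u v} → HubSeparated u v → colour c ε u ≢ colour c ε v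
      spokes≢ = hubSeparated⇒spokeColours≢ k≤2 rainbow

  rainbowConnection-m≤2 : 3 ≤ n → ∀ {m} → HasSize IsMaximalInvolution m → 1 ≤ m → m ≤ 2 →
                          RainbowConnectionNumber 3
  rainbowConnection-m≤2 3≤n hs@(f , _ , f-image) (s≤s z≤n) m≤2 =
    hasRainbowColouring hs (ℕ.≤-trans m≤2 (ℕ.n≤1+n 2)) ,
    λ k k<3 → noRainbowColouring≤2 3≤n (proj₂ (f-image ε) zero) (s≤s⁻¹ k<3)

  rainbowConnection-3≤m : ∀ {m} → HasSize IsMaximalInvolution m → 3 ≤ m → RainbowConnectionNumber m
  rainbowConnection-3≤m hs (s≤s (s≤s (s≤s _))) =
    hasRainbowColouring hs ℕ.≤-refl ,
    λ k k<m rainbow → ℕ.<⇒≱ k<m (maximalInvolutions≤colours hs rainbow)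

theorem2p1 : (n : ℕ) → 3 ≤ n →
    (_∙_ : Op₂ (Fin n)) (ε : Fin n) (_⁻¹ : Op₁ (Fin n)) →
    IsGroup _≡_ _∙_ ε _⁻¹ →
    (m : ℕ) → HasSize (PowerGraph.IsMaximalInvolution _∙_ ε) m →
    ((1 ≤ m × m ≤ 2) → PowerGraph.RainbowConnectionNumber _∙_ ε 3)
    × (3 ≤ m → PowerGraph.RainbowConnectionNumber _∙_ ε m)
theorem2p1 n 3≤n _∙_ ε _⁻¹ isGroup m hs =
  (λ (1≤m , m≤2) → rainbowConnection-m≤2 isGroup 3≤n hs 1≤m m≤2) , rainbowConnection-3≤m isGroup hs
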